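{- Let $k\geq 4$ be an even integer, let $G$ be a total $k$-uniform false twin-free graph, and let $uv$ be an arbitrary edge of $G$. Then $G\setminus (N[u]\cup N[v])$ is a total $(k-2)$-uniform false twin-free graph.
   Context: All graphs are finite and simple. $N(v)$ is the set of neighbors of $v$ and $N[v]=N(v)\cup\{v\}$; $G\setminus S$ denotes the graph obtained by deleting the vertices of $S$. Two distinct vertices $u,v$ are false twins if $N(u)=N(v)$; a graph is false twin-free if it has no false twins. For a graph $G$ with no isolated vertices, a total dominating set is a set $A\subseteq V(G)$ such that every vertex of $G$ has a neighbor in $A$; $\gamma_t(G)$ is the minimum size of one. A sequence $(v_1,\dots,v_m)$ of distinct vertices is legal if $N(v_i)\setminus\bigcup_{j=1}^{i-1}N(v_j)\neq\emptyset$ for every $i\in\{2,\dots,m\}$; it is a total dominating sequence if moreover $\{v_1,\dots,v_m\}$ is a total dominating set. $\gamma_{gr}^t(G)$ is the maximum length of a total dominating sequence. $G$ is total $k$-uniform if $\gamma_t(G)=\gamma_{gr}^t(G)=k$. -}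

module Defs where

open import Data.Nat using (ℕ; _≤_; _≥_)
open import Data.Bool using (Bool; true; false; _∨_)
open import Data.Fin using (Fin)
open import Data.Fin.Properties using (_≟_)
open import Data.Fin.Subset using (Subset; _∈_; _∉_; _⊆_; ∣_∣; ∁; _∪_)
open import Data.Vec using (tabulate)
open import Data.List using (List; []; _∷_; length)
open import Data.List.Relation.Unary.All using (All)
open import Data.List.Relation.Unary.Any using (Any)
open import Data.List.Relation.Unary.Unique.Propositional using (Unique)
open import Data.Product using (_×_; ∃; ∃-syntax)
open import Data.Unit using (⊤)
open import Relation.Nullary using (¬_; does)
open import Relation.Binary.PropositionalEquality using (_≡_; _≢_)

record Graph (n : ℕ) : Set where
  field
    Adj    : Fin n → Fin n → Bool
    sym    : ∀ x y → Adj x y ≡ Adj y x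
    irrefl : ∀ x → Adj x x ≡ false
open Graph public

module _ {n : ℕ} (G : Graph n) where

  NClosed : Fin n → Subset n
  NClosed u = tabulate (λ x → does (x ≟ u) ∨ Adj G u x)

  Delete : Subset n → Subset n
  Delete S = ∁ S

  -- All notions below concern the induced subgraph G[W] of G on the
  -- vertex set W (G itself is the case W = Data.Fin.Subset.⊤).
  module _ (W : Subset n) where

    NoIsolated : Set
    NoIsolated = ∀ v → v ∈ W → ∃[ x ] (x ∈ W × Adj G v x ≡ true)

    IsTDS : Subset n → Set
    IsTDS A = A ⊆ W × (∀ v → v ∈ W → ∃[ a ] (a ∈ A × Adj G v a ≡ true))

    GammaT≡ : ℕ → Set
    GammaT≡ k = (∃[ A ] (IsTDS A × ∣ A ∣ ≡ k))
              × (∀ A → IsTDS A → k ≤ ∣ A ∣)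

    LegalFrom : List (Fin n) → List (Fin n) → Set
    LegalFrom prev [] = ⊤
    LegalFrom prev (v ∷ vs) =
      (∃[ x ] (x ∈ W × Adj G v x ≡ true × All (λ u → Adj G u x ≡ false) prev))
      × LegalFrom (v ∷ prev) vs

    Legal : List (Fin n) → Set
    Legal [] = ⊤
    Legal (v ∷ vs) = LegalFrom (v ∷ []) vs

    IsLegalSeq : List (Fin n) → Set
    IsLegalSeq s = All (λ v → v ∈ W) s × Unique s × Legal s

    IsTDSeq : List (Fin n) → Set
    IsTDSeq s = IsLegalSeq s
              × (∀ v → v ∈ W → Any (λ a → Adj G v a ≡ true) s)

    GammaGrT≡ : ℕ → Set
    GammaGrT≡ k = (∃[ s ] (IsTDSeq s × length s ≡ k))
                × (∀ s → IsTDSeq s → length s ≤ k)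

    -- G[W] is total k-uniform (γ_t is only defined without isolated vertices).
    TotalUniform : ℕ → Set
    TotalUniform k = NoIsolated × GammaT≡ k × GammaGrT≡ k

    FalseTwinFree : Set
    FalseTwinFree = ∀ u v → u ∈ W → v ∈ W → u ≢ v →
                    ∃[ x ] (x ∈ W × Adj G u x ≢ Adj G v x)

{-# OPTIONS --safe #-}
module Submission where

-- In a graph G with γ_t(G) = γ_gr^t(G) = k, every legal sequence extends greedily to a total
-- dominating sequence, and every total dominating sequence has length exactly k. Hence if the
-- legal sequences s and s' satisfy N(s') ⊆ N(s), then |s'| ≤ |s|: extend s by t to a total
-- dominating sequence; then s' followed by t is still legal and extends further, so
-- |s'| + |t| ≤ k = |s| + |t|. For an edge uv, put F = V ∖ (N[u] ∪ N[v]). Every vertex outside F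
-- is dominated by u or v, so for a total dominating sequence t of G[F] the sequence (u, v, t) is
-- one of G, and a total dominating set of G[F] plus {u, v} is one of G; this gives
-- γ_t = γ_gr^t = k − 2 on G[F]. An isolated vertex w of G[F], or a vertex pair a, b of G[F] with N(b) ∩ F = N(a) ∩ F
-- but N(a) ⊈ N(b), would give the legal sequences (w, u, v), resp. (b, a, u, v), dominating no
-- more than (u, v), resp. (a, u, v), contrary to the comparison.

open import Defs hiding (sym)
open import Data.Nat using (ℕ; _≤_; _∸_; _+_; suc; zero; s≤s; z≤n)
open import Data.Nat.Properties
  using (≤-refl; ≤-trans; ≤-reflexive; ≤-antisym; +-suc; n≤1+n; +-monoʳ-≤; +-monoˡ-≤; +-cancelʳ-≤;
         m≤n+o⇒m∸n≤o; m+n∸m≡n; 1+n≰n; module ≤-Reasoning)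
open import Data.Nat.Divisibility using (_∣_)
open import Data.Bool using (Bool; true; false; _∨_)
import Data.Bool.Properties as Bool
open import Data.Fin using (Fin)
open import Data.Fin.Properties using (_≟_; any?)
open import Data.Fin.Subset using (Subset; ⊤; _∪_; _∈_; _∉_; _⊆_; _⊂_; ∣_∣; ⁅_⁆) renaming (⊥ to ∅)
open import Data.Fin.Subset.Properties
  using (_∈?_; ∈⊤; ∉⊥; ∣⊥∣≡0; ∣⁅x⁆∣≡1; x∈⁅x⁆; x∈⁅y⁆⇒x≡y; x∈p∪q⁺; x∈p∪q⁻; x∈∁p⇒x∉p; x∉∁p⇒x∈p;
         p⊂q⇒∣p∣<∣q∣)
open import Data.Vec using (tabulate; []; _∷_)
open import Data.Vec.Properties using (lookup∘tabulate; []=⇒lookup; lookup⇒[]=)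
open import Data.List using (List; []; _∷_; length; _++_; _ʳ++_; reverse)
open import Data.List.Properties using (length-++; length-++-≤ˡ)
open import Data.List.Membership.Propositional using (find) renaming (_∈_ to _∈ₗ_; _∉_ to _∉ₗ_)
open import Data.List.Relation.Unary.All as All using (All; []; _∷_)
open import Data.List.Relation.Unary.All.Properties using (¬Any⇒All¬; All¬⇒¬Any; ++⁺)
open import Data.List.Relation.Unary.Any as Any using (Any; here; there)
open import Data.List.Relation.Unary.Any.Properties using (reverse⁺; reverse⁻; ++⁺ˡ; ++⁺ʳ)
open import Data.List.Relation.Unary.Unique.Propositional using (Unique)
open import Data.List.Relation.Unary.AllPairs using ([]; _∷_)
open import Data.Product using (_×_; _,_; proj₁; proj₂; ∃-syntax; Σ-syntax)
open import Data.Sum using (_⊎_; inj₁; inj₂; [_,_])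
open import Data.Empty using (⊥-elim)
open import Data.Unit using (tt)
open import Function using (_∘_; id; Equivalence; mk⇔)
open import Relation.Nullary using (¬_; yes; no; does; isYes)
open import Relation.Nullary.Decidable using (dec-true; toWitness; fromWitness; decidable-stable; _×-dec_; ¬?)
open import Relation.Unary using (Decidable)
open import Relation.Binary.PropositionalEquality using (_≡_; refl; sym; trans; cong; module ≡-Reasoning)

∣p∪q∣≤∣p∣+∣q∣ : ∀ {n} (p q : Subset n) → ∣ p ∪ q ∣ ≤ ∣ p ∣ + ∣ q ∣
∣p∪q∣≤∣p∣+∣q∣ []          []          = z≤n
∣p∪q∣≤∣p∣+∣q∣ (true ∷ p)  (true ∷ q)  = s≤s (≤-trans (∣p∪q∣≤∣p∣+∣q∣ p q) (+-monoʳ-≤ ∣ p ∣ (n≤1+n ∣ q ∣)))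
∣p∪q∣≤∣p∣+∣q∣ (true ∷ p)  (false ∷ q) = s≤s (∣p∪q∣≤∣p∣+∣q∣ p q)
∣p∪q∣≤∣p∣+∣q∣ (false ∷ p) (true ∷ q)  = ≤-trans (s≤s (∣p∪q∣≤∣p∣+∣q∣ p q)) (≤-reflexive (sym (+-suc ∣ p ∣ ∣ q ∣)))
∣p∪q∣≤∣p∣+∣q∣ (false ∷ p) (false ∷ q) = ∣p∪q∣≤∣p∣+∣q∣ p q

module _ {n : ℕ} where

  x∈tabulate⁺ : (f : Fin n → Bool) {x : Fin n} → f x ≡ true → x ∈ tabulate f
  x∈tabulate⁺ f {x} fx = lookup⇒[]= x (tabulate f) (trans (lookup∘tabulate f x) fx)

  x∈tabulate⁻ : (f : Fin n → Bool) {x : Fin n} → x ∈ tabulate f → f x ≡ true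
  x∈tabulate⁻ f {x} x∈ = trans (sym (lookup∘tabulate f x)) ([]=⇒lookup x∈)

  all-∈⊤ : (s : List (Fin n)) → All (_∈ ⊤) s
  all-∈⊤ s = All.tabulate (λ _ → ∈⊤)

  toSubset : List (Fin n) → Subset n
  toSubset []       = ∅
  toSubset (a ∷ as) = ⁅ a ⁆ ∪ toSubset as

  ∣toSubset∣≤length : ∀ as → ∣ toSubset as ∣ ≤ length as
  ∣toSubset∣≤length []       = ≤-reflexive (∣⊥∣≡0 n)
  ∣toSubset∣≤length (a ∷ as) = begin
    ∣ ⁅ a ⁆ ∪ toSubset as ∣      ≤⟨ ∣p∪q∣≤∣p∣+∣q∣ ⁅ a ⁆ (toSubset as) ⟩
    ∣ ⁅ a ⁆ ∣ + ∣ toSubset as ∣  ≡⟨ cong (_+ ∣ toSubset as ∣) (∣⁅x⁆∣≡1 a) ⟩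
    suc ∣ toSubset as ∣          ≤⟨ s≤s (∣toSubset∣≤length as) ⟩
    suc (length as)              ∎
    where open ≤-Reasoning

  ∈toSubset⁺ : ∀ {as x} → x ∈ₗ as → x ∈ toSubset as
  ∈toSubset⁺ (here refl) = x∈p∪q⁺ (inj₁ (x∈⁅x⁆ _))
  ∈toSubset⁺ (there x∈)  = x∈p∪q⁺ (inj₂ (∈toSubset⁺ x∈))

  ∈toSubset⁻ : ∀ as {x} → x ∈ toSubset as → x ∈ₗ as
  ∈toSubset⁻ []       x∈ = ⊥-elim (∉⊥ x∈)
  ∈toSubset⁻ (a ∷ as) x∈ = [ here ∘ x∈⁅y⁆⇒x≡y a , there ∘ ∈toSubset⁻ as ] (x∈p∪q⁻ ⁅ a ⁆ (toSubset as) x∈)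

module _ {n : ℕ} (G : Graph n) where

  Dominates : List (Fin n) → Fin n → Set
  Dominates s z = Any (λ a → Adj G a z ≡ true) s

  dominates? : ∀ s → Decidable (Dominates s)
  dominates? s z = Any.any? (λ a → Adj G a z Bool.≟ true) s

  Dominates⇒Any-Adj : ∀ {s z} → Dominates s z → Any (λ a → Adj G z a ≡ true) s
  Dominates⇒Any-Adj {z = z} = Any.map λ {a} az → trans (Graph.sym G z a) az

  nonadjacent⇒¬Dominates : ∀ {p x} → All (λ a → Adj G a x ≡ false) p → ¬ Dominates p x
  nonadjacent⇒¬Dominates = All¬⇒¬Any ∘ All.map Bool.not-¬

  ¬Dominates⇒nonadjacent : ∀ p {x} → ¬ Dominates p x → All (λ a → Adj G a x ≡ false) p
  ¬Dominates⇒nonadjacent p = All.map Bool.¬-not ∘ ¬Any⇒All¬ p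

  LegalFrom-mono : ∀ {W W′ p p′} → W ⊆ W′ → ∀ t →
                   (∀ x → x ∈ W → Dominates p′ x → Dominates p x) →
                   LegalFrom G W p t → LegalFrom G W′ p′ t
  LegalFrom-mono W⊆W′ []      _     _ = tt
  LegalFrom-mono {W} {p = p} {p′} W⊆W′ (v ∷ t) p′⊑p ((x , x∈W , vx , p≁x) , rest) =
    (x , W⊆W′ x∈W , vx , ¬Dominates⇒nonadjacent p′ (nonadjacent⇒¬Dominates p≁x ∘ p′⊑p x x∈W)) ,
    LegalFrom-mono W⊆W′ t vp′⊑vp rest
    where
    vp′⊑vp : ∀ y → y ∈ W → Dominates (v ∷ p′) y → Dominates (v ∷ p) y
    vp′⊑vp y _   (here vy) = here vy
    vp′⊑vp y y∈W (there d) = there (p′⊑p y y∈W d)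

  -- LegalFrom keeps the vertices played so far in reverse order.
  LegalFrom-++ : ∀ {W} p a {b} → LegalFrom G W p a → LegalFrom G W (a ʳ++ p) b → LegalFrom G W p (a ++ b)
  LegalFrom-++ p []      _              legal-b = legal-b
  LegalFrom-++ p (x ∷ a) (x-ok , legal-a) legal-b = x-ok , LegalFrom-++ (x ∷ p) a legal-a legal-b

  LegalFrom⇒Unique : ∀ {W} p t → LegalFrom G W p t → Unique t × All (_∉ₗ p) t
  LegalFrom⇒Unique p []      _ = [] , []
  LegalFrom⇒Unique p (v ∷ t) ((x , _ , vx , p≁x) , rest) with LegalFrom⇒Unique (v ∷ p) t rest
  ... | unique , fresh =
    All.map (λ a∉ v≡a → a∉ (here (sym v≡a))) fresh ∷ unique , v∉p ∷ All.map (_∘ there) fresh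
    where
    v∉p : v ∉ₗ p
    v∉p = nonadjacent⇒¬Dominates p≁x ∘ Any.map λ { refl → vx }

  Legal⇒LegalFrom[] : ∀ {W} → NoIsolated G W → ∀ {s} → All (_∈ W) s → Legal G W s → LegalFrom G W [] s
  Legal⇒LegalFrom[] noIsolated {[]}    _         _     = tt
  Legal⇒LegalFrom[] noIsolated {v ∷ t} (v∈W ∷ _) legal with noIsolated v v∈W
  ... | x , x∈W , vx = (x , x∈W , vx , []) , legal

  LegalFrom[]⇒IsLegalSeq : ∀ {W} s → All (_∈ W) s → LegalFrom G W [] s → IsLegalSeq G W s
  LegalFrom[]⇒IsLegalSeq []      _   _     = [] , [] , tt
  LegalFrom[]⇒IsLegalSeq (v ∷ t) s⊆W legal = s⊆W , proj₁ (LegalFrom⇒Unique [] (v ∷ t) legal) , proj₂ legal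

  TDSeq⇒TDS : ∀ {W} s → IsTDSeq G W s → IsTDS G W (toSubset s)
  TDSeq⇒TDS s ((s⊆W , _ , _) , dominated) =
    (λ x∈ → All.lookup s⊆W (∈toSubset⁻ s x∈)) ,
    λ v v∈W → let a , a∈s , va = find (dominated v v∈W) in a , ∈toSubset⁺ a∈s , va

  module _ {W : Subset n} where

    Undominated : List (Fin n) → Subset n
    Undominated p = tabulate λ z → isYes (z ∈? W ×-dec ¬? (dominates? p z))

    ∈Undominated⁺ : ∀ {p x} → x ∈ W → ¬ Dominates p x → x ∈ Undominated p
    ∈Undominated⁺ x∈W ¬d = x∈tabulate⁺ _ (Equivalence.to Bool.T-≡ (fromWitness (x∈W , ¬d)))

    ∈Undominated⁻ : ∀ {p x} → x ∈ Undominated p → x ∈ W × ¬ Dominates p x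
    ∈Undominated⁻ x∈ = toWitness (Equivalence.from Bool.T-≡ (x∈tabulate⁻ _ x∈))

    undominated-shrinks : ∀ {p z y} → z ∈ Undominated p → Adj G z y ≡ true →
                          Undominated (y ∷ p) ⊂ Undominated p
    undominated-shrinks {z = z} {y} z∈U zy =
      (λ x∈U′ → let x∈W , ¬d = ∈Undominated⁻ x∈U′ in ∈Undominated⁺ x∈W (¬d ∘ there)) ,
      z , z∈U , λ z∈U′ → proj₂ (∈Undominated⁻ z∈U′) (here (trans (Graph.sym G y z) zy))

    Extension : List (Fin n) → Set
    Extension p = Σ[ t ∈ List (Fin n) ] LegalFrom G W p t × All (_∈ W) t ×
                  (∀ z → z ∈ W → Dominates p z ⊎ Dominates t z)

    prepend : ∀ {p z y} → z ∈ Undominated p → y ∈ W → Adj G z y ≡ true → Extension (y ∷ p) → Extension p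
    prepend {p} {z} {y} z∈U y∈W zy (t , legal , t⊆W , covers) with ∈Undominated⁻ z∈U
    ... | z∈W , ¬d =
      y ∷ t , ((z , z∈W , trans (Graph.sym G y z) zy , ¬Dominates⇒nonadjacent p ¬d) , legal) ,
      y∈W ∷ t⊆W , covers′
      where
      covers′ : ∀ x → x ∈ W → Dominates p x ⊎ Dominates (y ∷ t) x
      covers′ x x∈W with covers x x∈W
      ... | inj₁ (here yx) = inj₂ (here yx)
      ... | inj₁ (there d) = inj₁ d
      ... | inj₂ d         = inj₂ (there d)

  module _ {W : Subset n} (noIsolated : NoIsolated G W) where

    extend : ∀ m p → ∣ Undominated p ∣ ≤ m → Extension p
    extend m p bound with any? (_∈? Undominated p)
    ... | no none = [] , tt , [] , λ z z∈W →
      inj₁ (decidable-stable (dominates? p z) λ ¬d → none (z , ∈Undominated⁺ z∈W ¬d))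
    ... | yes (z , z∈U) with noIsolated z (proj₁ (∈Undominated⁻ z∈U))
    ...   | y , y∈W , zy with m | ≤-trans (p⊂q⇒∣p∣<∣q∣ (undominated-shrinks z∈U zy)) bound
    ...     | zero   | ()
    ...     | suc m′ | s≤s bound′ = prepend z∈U y∈W zy (extend m′ (y ∷ p) bound′)

    complete : ∀ r → All (_∈ W) r → LegalFrom G W [] r →
               Σ[ t ∈ List (Fin n) ] IsTDSeq G W (r ++ t) × LegalFrom G W (reverse r) t
    complete r r⊆W r-legal with extend _ (reverse r) ≤-refl
    ... | t , t-legal , t⊆W , covers =
      t , (LegalFrom[]⇒IsLegalSeq (r ++ t) (++⁺ r⊆W t⊆W) (LegalFrom-++ [] r r-legal t-legal) ,
           λ z z∈W → Dominates⇒Any-Adj ([ ++⁺ˡ ∘ reverse⁻ {xs = r} , ++⁺ʳ r ] (covers z z∈W))) ,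
      t-legal

    totalUniform-intro : ∀ {k} → (∀ A → IsTDS G W A → k ≤ ∣ A ∣) →
                         (∀ s → IsTDSeq G W s → length s ≡ k) → TotalUniform G W k
    totalUniform-intro γt-lower length≡k with complete [] [] tt
    ... | s , s-tdseq , _ =
      noIsolated ,
      ((toSubset s , TDSeq⇒TDS s s-tdseq ,
        ≤-antisym (≤-trans (∣toSubset∣≤length s) (≤-reflexive (length≡k s s-tdseq)))
                  (γt-lower _ (TDSeq⇒TDS s s-tdseq))) , γt-lower) ,
      ((s , s-tdseq , length≡k s s-tdseq) , λ s′ s′-tdseq → ≤-reflexive (length≡k s′ s′-tdseq))

  ∈NClosed⁺ : ∀ {u x} → x ≡ u ⊎ Adj G u x ≡ true → x ∈ NClosed G u
  ∈NClosed⁺ {u} (inj₁ refl) = x∈tabulate⁺ _ (cong (_∨ Adj G u u) (dec-true (u ≟ u) refl))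
  ∈NClosed⁺ {u} {x} (inj₂ ux) = x∈tabulate⁺ _ (trans (cong (does (x ≟ u) ∨_) ux) (Bool.∨-zeroʳ _))

  ∈NClosed⁻ : ∀ {u x} → x ∈ NClosed G u → x ≡ u ⊎ Adj G u x ≡ true
  ∈NClosed⁻ {u} {x} x∈ with x ≟ u | x∈tabulate⁻ _ x∈
  ... | yes x≡u | _  = inj₁ x≡u
  ... | no _    | ux = inj₂ ux

  Far : Fin n → Fin n → Subset n
  Far u v = Delete G (NClosed G u ∪ NClosed G v)

  Far⇒undominated : ∀ {u v x} → x ∈ Far u v → ¬ Dominates (u ∷ v ∷ []) x
  Far⇒undominated x∈F (here ux)         = x∈∁p⇒x∉p x∈F (x∈p∪q⁺ (inj₁ (∈NClosed⁺ (inj₂ ux))))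
  Far⇒undominated x∈F (there (here vx)) = x∈∁p⇒x∉p x∈F (x∈p∪q⁺ (inj₂ (∈NClosed⁺ (inj₂ vx))))

  ¬Far⇒dominated : ∀ {u v} → Adj G u v ≡ true → ∀ {x} → x ∉ Far u v → Dominates (u ∷ v ∷ []) x
  ¬Far⇒dominated {u} {v} uv x∉F with x∈p∪q⁻ (NClosed G u) (NClosed G v) (x∉∁p⇒x∈p x∉F)
  ... | inj₁ x∈Nu with ∈NClosed⁻ x∈Nu
  ...   | inj₁ refl = there (here (trans (Graph.sym G v u) uv))
  ...   | inj₂ ux   = here ux
  ¬Far⇒dominated uv x∉F | inj₂ x∈Nv with ∈NClosed⁻ x∈Nv
  ...   | inj₁ refl = here uv
  ...   | inj₂ vx   = there (here vx)

  edge-legal-after : ∀ {u v} → Adj G u v ≡ true → ∀ {p} →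
                     All (λ a → ¬ Dominates (u ∷ v ∷ []) a) p → LegalFrom G ⊤ p (u ∷ v ∷ [])
  edge-legal-after {u} {v} uv p-far =
    (v , ∈⊤ , uv , All.map v≁ p-far) ,
    (u , ∈⊤ , trans (Graph.sym G v u) uv , Graph.irrefl G u ∷ All.map u≁ p-far) , tt
    where
    u≁ : ∀ {a} → ¬ Dominates (u ∷ v ∷ []) a → Adj G a u ≡ false
    u≁ {a} ¬d = Bool.¬-not (¬d ∘ here ∘ trans (Graph.sym G u a))
    v≁ : ∀ {a} → ¬ Dominates (u ∷ v ∷ []) a → Adj G a v ≡ false
    v≁ {a} ¬d = Bool.¬-not (¬d ∘ there ∘ here ∘ trans (Graph.sym G v a))

  module TotalUniformGraph {k : ℕ} (noIsolated : NoIsolated G ⊤)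
                           (γt-lower : ∀ A → IsTDS G ⊤ A → k ≤ ∣ A ∣)
                           (γgr-upper : ∀ s → IsTDSeq G ⊤ s → length s ≤ k) where

    TDSeq-length : ∀ s → IsTDSeq G ⊤ s → length s ≡ k
    TDSeq-length s s-tdseq =
      ≤-antisym (γgr-upper s s-tdseq) (≤-trans (γt-lower _ (TDSeq⇒TDS s s-tdseq)) (∣toSubset∣≤length s))

    legal-length-mono : ∀ s s′ → LegalFrom G ⊤ [] s → LegalFrom G ⊤ [] s′ →
                        (∀ z → Dominates s′ z → Dominates s z) → length s′ ≤ length s
    legal-length-mono s s′ s-legal s′-legal s′⊑s with complete noIsolated s (all-∈⊤ s) s-legal
    ... | t , s++t-tdseq , t-legal
      with complete noIsolated (s′ ++ t) (all-∈⊤ _)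
             (LegalFrom-++ [] s′ s′-legal
               (LegalFrom-mono id t (λ x _ → reverse⁺ ∘ s′⊑s x ∘ reverse⁻) t-legal))
    ... | t′ , s′++t++t′-tdseq , _ = +-cancelʳ-≤ (length t) (length s′) (length s) (begin
      length s′ + length t      ≡⟨ length-++ s′ ⟨
      length (s′ ++ t)          ≤⟨ length-++-≤ˡ (s′ ++ t) ⟩
      length ((s′ ++ t) ++ t′)  ≡⟨ TDSeq-length _ s′++t++t′-tdseq ⟩
      k                         ≡⟨ TDSeq-length _ s++t-tdseq ⟨
      length (s ++ t)           ≡⟨ length-++ s ⟩
      length s + length t       ∎)
      where open ≤-Reasoning

    prepend-dominates-new : ∀ w s → LegalFrom G ⊤ [] s → LegalFrom G ⊤ [] (w ∷ s) →
                            ¬ (∀ z → Adj G w z ≡ true → Dominates s z)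
    prepend-dominates-new w s s-legal ws-legal covered =
      1+n≰n (legal-length-mono s (w ∷ s) s-legal ws-legal λ where
        z (here wz) → covered z wz
        z (there d) → d)

    module _ {u v : Fin n} (uv : Adj G u v ≡ true) where

      uv-legal-after : ∀ {p} → All (_∈ Far u v) p → LegalFrom G ⊤ p (u ∷ v ∷ [])
      uv-legal-after = edge-legal-after uv ∘ All.map Far⇒undominated

      Far-noIsolated : NoIsolated G (Far u v)
      Far-noIsolated w w∈F =
        decidable-stable (any? λ x → x ∈? Far u v ×-dec (Adj G w x Bool.≟ true)) λ isolated →
          prepend-dominates-new w (u ∷ v ∷ []) (uv-legal-after [])
            (Legal⇒LegalFrom[] noIsolated (all-∈⊤ _) (uv-legal-after (w∈F ∷ [])))
            (covered isolated)
        where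
        covered : ¬ (∃[ x ] (x ∈ Far u v × Adj G w x ≡ true)) →
                  ∀ z → Adj G w z ≡ true → Dominates (u ∷ v ∷ []) z
        covered isolated z wz with z ∈? Far u v
        ... | yes z∈F = ⊥-elim (isolated (z , z∈F , wz))
        ... | no z∉F  = ¬Far⇒dominated uv z∉F

      Far-twin-neighbours : ∀ {a b} → a ∈ Far u v → b ∈ Far u v →
                            (∀ z → z ∈ Far u v → Adj G a z ≡ Adj G b z) →
                            ∀ z → Adj G a z ≡ true → Adj G b z ≡ true
      Far-twin-neighbours {a} {b} a∈F b∈F agree z az = Bool.¬-not λ bz →
        prepend-dominates-new b (a ∷ u ∷ v ∷ [])
          (Legal⇒LegalFrom[] noIsolated (all-∈⊤ _) (uv-legal-after (a∈F ∷ [])))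
          (Legal⇒LegalFrom[] noIsolated (all-∈⊤ _)
            ((z , ∈⊤ , az , bz ∷ []) , uv-legal-after (a∈F ∷ b∈F ∷ [])))
          covered
        where
        covered : ∀ y → Adj G b y ≡ true → Dominates (a ∷ u ∷ v ∷ []) y
        covered y by with y ∈? Far u v
        ... | yes y∈F = here (trans (agree y y∈F) by)
        ... | no y∉F  = there (¬Far⇒dominated uv y∉F)

      Far-falseTwinFree : FalseTwinFree G ⊤ → FalseTwinFree G (Far u v)
      Far-falseTwinFree twinFree a b a∈F b∈F a≢b =
        decidable-stable (any? λ z → z ∈? Far u v ×-dec ¬? (Adj G a z Bool.≟ Adj G b z)) twins-impossible
        where
        twins-impossible : ¬ ¬ (∃[ z ] (z ∈ Far u v × ¬ Adj G a z ≡ Adj G b z))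
        twins-impossible unseparated with twinFree a b ∈⊤ ∈⊤ a≢b
        ... | x , _ , differ =
          differ (Bool.⇔→≡ (mk⇔ (Far-twin-neighbours a∈F b∈F agree x)
                                (Far-twin-neighbours b∈F a∈F (λ z z∈F → sym (agree z z∈F)) x)))
          where
          agree : ∀ z → z ∈ Far u v → Adj G a z ≡ Adj G b z
          agree z z∈F = decidable-stable (Adj G a z Bool.≟ Adj G b z) λ ne → unseparated (z , z∈F , ne)

      uv-prefixed-TDSeq : ∀ t → IsTDSeq G (Far u v) t → IsTDSeq G ⊤ (u ∷ v ∷ t)
      uv-prefixed-TDSeq t ((t⊆F , _ , t-legal) , t-dominated) =
        LegalFrom[]⇒IsLegalSeq (u ∷ v ∷ t) (all-∈⊤ _)
          (LegalFrom-++ [] (u ∷ v ∷ []) (uv-legal-after []) t-legal′) , dominated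
        where
        t-legal′ : LegalFrom G ⊤ (reverse (u ∷ v ∷ [])) t
        t-legal′ = LegalFrom-mono (λ _ → ∈⊤) t (λ x x∈F d → ⊥-elim (Far⇒undominated x∈F (reverse⁻ d)))
                     (Legal⇒LegalFrom[] Far-noIsolated t⊆F t-legal)
        dominated : ∀ z → z ∈ ⊤ → Any (λ a → Adj G z a ≡ true) (u ∷ v ∷ t)
        dominated z _ with z ∈? Far u v
        ... | yes z∈F = there (there (t-dominated z z∈F))
        ... | no z∉F  = ++⁺ˡ (Dominates⇒Any-Adj (¬Far⇒dominated uv z∉F))

      Far-TDSeq-length : ∀ t → IsTDSeq G (Far u v) t → length t ≡ k ∸ 2
      Far-TDSeq-length t t-tdseq = begin
        length t              ≡⟨ m+n∸m≡n 2 (length t) ⟨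
        2 + length t ∸ 2      ≡⟨ cong (_∸ 2) (TDSeq-length _ (uv-prefixed-TDSeq t t-tdseq)) ⟩
        k ∸ 2                 ∎
        where open ≡-Reasoning

      uv-extended-TDS : ∀ A → IsTDS G (Far u v) A → IsTDS G ⊤ (toSubset (u ∷ v ∷ []) ∪ A)
      uv-extended-TDS A (_ , A-dominates) = (λ _ → ∈⊤) , dominated
        where
        dominated : ∀ z → z ∈ ⊤ → ∃[ a ] (a ∈ toSubset (u ∷ v ∷ []) ∪ A × Adj G z a ≡ true)
        dominated z _ with z ∈? Far u v
        ... | yes z∈F = let a , a∈A , za = A-dominates z z∈F in a , x∈p∪q⁺ (inj₂ a∈A) , za
        ... | no z∉F  = let a , a∈uv , za = find (Dominates⇒Any-Adj (¬Far⇒dominated uv z∉F))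
                        in a , x∈p∪q⁺ (inj₁ (∈toSubset⁺ a∈uv)) , za

      Far-γt-lower : ∀ A → IsTDS G (Far u v) A → k ∸ 2 ≤ ∣ A ∣
      Far-γt-lower A A-tds = m≤n+o⇒m∸n≤o k 2 (begin
        k                                        ≤⟨ γt-lower _ (uv-extended-TDS A A-tds) ⟩
        ∣ toSubset (u ∷ v ∷ []) ∪ A ∣            ≤⟨ ∣p∪q∣≤∣p∣+∣q∣ (toSubset (u ∷ v ∷ [])) A ⟩
        ∣ toSubset (u ∷ v ∷ []) ∣ + ∣ A ∣        ≤⟨ +-monoˡ-≤ ∣ A ∣ (∣toSubset∣≤length (u ∷ v ∷ [])) ⟩
        2 + ∣ A ∣                                ∎)
        where open ≤-Reasoning

      Far-totalUniform : TotalUniform G (Far u v) (k ∸ 2)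
      Far-totalUniform = totalUniform-intro Far-noIsolated Far-γt-lower Far-TDSeq-length

proposition2p7 : ∀ {n} (G : Graph n) (k : ℕ) → 4 ≤ k → 2 ∣ k →
    TotalUniform G ⊤ k → FalseTwinFree G ⊤ →
    (u v : Fin n) → Adj G u v ≡ true →
    TotalUniform G (Delete G (NClosed G u ∪ NClosed G v)) (k ∸ 2)
    × FalseTwinFree G (Delete G (NClosed G u ∪ NClosed G v))
proposition2p7 G k _ _ (noIsolated , (_ , γt-lower) , (_ , γgr-upper)) twinFree u v uv =
  Far-totalUniform uv , Far-falseTwinFree uv twinFree
  where open TotalUniformGraph G noIsolated γt-lower γgr-upper
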